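{- Let $n\ge 4$. Then $-4$ is an eigenvalue of $\mathcal{Q}(n)$ with multiplicity $(n-3)^2$, and the family $\mathcal{F}_n=\{X_n^{(a,b)}\mid (a,b)\in[n-3]^2\}$ is a basis of the eigenspace of $\mathcal{Q}(n)$ associated with $-4$.
   Context: The $n$-Queens' graph $\mathcal{Q}(n)$ has vertex set $[n]^2$ (squares $(i,j)$ of an $n\times n$ chessboard); two distinct vertices $(i,j),(p,q)$ are adjacent iff $i=p$, or $j=q$, or $i+j=p+q$, or $i-j=p-q$. Vectors in $\mathbb{R}^{n^2}$ are indexed by $[n]^2$. Let $X_4\in\mathbb{R}^{16}$ be the $4\times4$ array with rows $(0,1,-1,0)$, $(-1,0,0,1)$, $(1,0,0,-1)$, $(0,-1,1,0)$ (i.e. $[X_4]_{(1,2)}=1$, $[X_4]_{(1,3)}=-1$, etc.). For $(a,b)\in[n-3]^2$, with $A=\{a,\dots,a+3\}$ and $B=\{b,\dots,b+3\}$, define $[X_n^{(a,b)}]_{(i,j)}=[X_4]_{(i-a+1,j-b+1)}$ if $(i,j)\in A\times B$ and $0$ otherwise.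
   Formalization: The vectors indexed by $[n]^2$, hence the eigenspace of $\mathcal{Q}(n)$ associated with $-4$, and the coefficients of combinations of $\mathcal{F}_n$ are taken over ℚ instead of ℝ. -}

module Defs where

open import Data.Nat as ℕ using (ℕ; zero; suc; _∸_; _≡ᵇ_; _≤ᵇ_)
open import Data.Fin using (Fin; toℕ)
open import Data.Bool using (Bool; true; false; _∨_; not; _∧_; if_then_else_)
open import Data.Integer using (+_)
open import Data.Rational using (ℚ; 0ℚ; 1ℚ; _+_; _*_; -_; _/_)

-- Vectors in ℚ^{n²}, indexed by squares (i,j) ∈ [n]² (0-based: Fin n × Fin n).
Vec² : ℕ → Set
Vec² n = Fin n → Fin n → ℚ

ΣFin : ∀ {n} → (Fin n → ℚ) → ℚ
ΣFin {zero} f = 0ℚ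
ΣFin {suc n} f = f Fin.zero + ΣFin (λ k → f (Fin.suc k))
  where import Data.Fin as Fin

-- Adjacency in the n-Queens graph Q(n): distinct squares on a common
-- row, column, or diagonal (i+j = p+q) or anti-diagonal (i-j = p-q,
-- written i+q = p+j to stay in ℕ).
adjᵇ : ∀ {n} → Fin n → Fin n → Fin n → Fin n → Bool
adjᵇ i j p q =
  not ((I ≡ᵇ P) ∧ (J ≡ᵇ Q)) ∧
  ((I ≡ᵇ P) ∨ (J ≡ᵇ Q) ∨ ((I ℕ.+ J) ≡ᵇ (P ℕ.+ Q)) ∨ ((I ℕ.+ Q) ≡ᵇ (P ℕ.+ J)))
  where
  I = toℕ i
  J = toℕ j
  P = toℕ p
  Q = toℕ q

adj : ∀ {n} → Fin n → Fin n → Fin n → Fin n → ℚ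
adj i j p q = if adjᵇ i j p q then 1ℚ else 0ℚ

applyQ : ∀ {n} → Vec² n → Vec² n
applyQ v i j = ΣFin (λ p → ΣFin (λ q → adj i j p q * v p q))

InEigenspace : ∀ n → ℚ → Vec² n → Set
InEigenspace n λ' v = ∀ i j → applyQ v i j ≡ λ' * v i j
  where open import Relation.Binary.PropositionalEquality using (_≡_)

minus4 : ℚ
minus4 = - (+ 4 / 1)

-- X₄ with 0-based indices; 0 outside {0..3}².
X4 : ℕ → ℕ → ℚ
X4 0 1 = 1ℚ
X4 0 2 = - 1ℚ
X4 1 0 = - 1ℚ
X4 1 3 = 1ℚ
X4 2 0 = 1ℚ
X4 2 3 = - 1ℚ
X4 3 1 = - 1ℚ
X4 3 2 = 1ℚ
X4 _ _ = 0ℚ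

-- X_n^{(a,b)} for (a,b) ∈ [n-3]² (0-based a,b : Fin (n ∸ 3)):
-- the copy of X₄ placed on rows a..a+3, columns b..b+3.
Xn : ∀ n → Fin (n ∸ 3) → Fin (n ∸ 3) → Vec² n
Xn n a b i j =
  if (toℕ a ≤ᵇ toℕ i) ∧ (toℕ b ≤ᵇ toℕ j)
  then X4 (toℕ i ∸ toℕ a) (toℕ j ∸ toℕ b)
  else 0ℚ

combX : ∀ n → (Fin (n ∸ 3) → Fin (n ∸ 3) → ℚ) → Vec² n
combX n c i j = ΣFin (λ a → ΣFin (λ b → c a b * Xn n a b i j))

-- The adjacency operator Q of 𝒬(n) satisfies Q + 4I = R + C + D + D', where R, C, D, D' relate
-- two squares lying on a common row, column, diagonal, anti-diagonal: two distinct squares share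
-- at most one line, and a square shares all four with itself. So ⟨v, (Q + 4I) v⟩ is the sum of
-- the squares of all line sums of v, and v is a (-4)-eigenvector iff every line sum of v is 0.
-- The lines of X₄ all sum to 0, hence so do those of every X^{(a,b)}. The vector X^{(a,b)} is 1
-- at its pivot (a, b+1) and 0 at the pivots of all lexicographically earlier (a', b'), which gives
-- linear independence, and by elimination reduces spanning to: a vector with zero line sums that
-- vanishes at all pivots is zero. For that, the first n-3 rows and then all columns are
-- cleared one by one, each time along a line on which a single unknown square is left.

module Submission where

open import Defs
open import Data.Nat as ℕ using (ℕ; zero; suc; _∸_; _≡ᵇ_; _≤ᵇ_; z≤n; s≤s; _≤_; _<_)
import Data.Nat.Properties as ℕₚ
open import Data.Nat.Tactic.RingSolver using (solve-∀)
open import Data.Fin as Fin using (Fin; toℕ; fromℕ<)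
import Data.Fin.Properties as Finₚ
open import Data.Bool using (Bool; true; false; if_then_else_; _∧_; _∨_; not)
open import Data.Bool.Properties using (∧-zeroʳ)
import Data.Integer as ℤ
open import Data.Rational using (ℚ; 0ℚ; 1ℚ; _+_; _*_; -_; _-_; _/_) renaming (_≤_ to _≤ℚ_)
import Data.Rational as ℚ
import Data.Rational.Properties as ℚₚ
open import Data.Product using (_×_; Σ; _,_; proj₁; proj₂)
open import Data.Sum using (_⊎_; inj₁; inj₂)
open import Data.Empty using (⊥-elim)
open import Function using (_∘′_; _⇔_; mk⇔; Equivalence)
open import Level using (0ℓ)
open import Relation.Nullary using (¬_; Reflects; ofʸ; ofⁿ; proof; yes; no)
open import Relation.Nullary.Decidable using (dec⇒maybe)
open import Data.Product.Relation.Binary.Lex.Strict using (×-Lex; ×-compare)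
open import Data.Product.Relation.Binary.Pointwise.NonDependent using (Pointwise)
open import Relation.Binary.Definitions using (Trichotomous; tri<; tri≈; tri>)
open import Relation.Binary.PropositionalEquality
  using (_≡_; _≢_; refl; sym; trans; cong; cong₂; subst; subst₂; module ≡-Reasoning)
import Tactic.RingSolver as Tactic
open import Tactic.RingSolver.Core.AlmostCommutativeRing
  using (AlmostCommutativeRing; fromCommutativeRing)

ℚ-ring : AlmostCommutativeRing 0ℓ 0ℓ
ℚ-ring = fromCommutativeRing ℚₚ.+-*-commutativeRing (λ x → dec⇒maybe (0ℚ ℚₚ.≟ x))

𝟙 : Bool → ℚ
𝟙 b = if b then 1ℚ else 0ℚ

≡ᵇ-reflects : ∀ m n → Reflects (m ≡ n) (m ≡ᵇ n)
≡ᵇ-reflects m n = proof (m ℕ.≟ n)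

≡ᵇ-refl : ∀ m → (m ≡ᵇ m) ≡ true
≡ᵇ-refl m with m ≡ᵇ m | ≡ᵇ-reflects m m
... | true  | _      = refl
... | false | ofⁿ ne = ⊥-elim (ne refl)

≢⇒≡ᵇ-false : ∀ {m n} → m ≢ n → (m ≡ᵇ n) ≡ false
≢⇒≡ᵇ-false {m} {n} m≢n with m ≡ᵇ n | ≡ᵇ-reflects m n
... | true  | ofʸ m≡n = ⊥-elim (m≢n m≡n)
... | false | _       = refl

≡ᵇ-respects-⇔ : ∀ {a b c d} → (a ≡ b → c ≡ d) → (c ≡ d → a ≡ b) → (a ≡ᵇ b) ≡ (c ≡ᵇ d)
≡ᵇ-respects-⇔ {a} {b} {c} {d} to from with a ≡ᵇ b | ≡ᵇ-reflects a b | c ≡ᵇ d | ≡ᵇ-reflects c d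
... | true  | _        | true  | _        = refl
... | false | _        | false | _        = refl
... | true  | ofʸ a≡b  | false | ofⁿ c≢d  = ⊥-elim (c≢d (to a≡b))
... | false | ofⁿ a≢b  | true  | ofʸ c≡d  = ⊥-elim (a≢b (from c≡d))

≤ᵇ-false : ∀ {m n} → n < m → (m ≤ᵇ n) ≡ false
≤ᵇ-false {m} {n} n<m with m ≤ᵇ n | ℕₚ.≤ᵇ-reflects-≤ m n
... | true  | ofʸ m≤n = ⊥-elim (ℕₚ.<⇒≱ n<m m≤n)
... | false | _       = refl

≤ᵇ-true : ∀ {m n} → m ≤ n → (m ≤ᵇ n) ≡ true
≤ᵇ-true {m} {n} m≤n with m ≤ᵇ n | ℕₚ.≤ᵇ-reflects-≤ m n
... | true  | _       = refl
... | false | ofⁿ m≰n = ⊥-elim (m≰n m≤n)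

ΣΣ : ∀ {m n} → (Fin m → Fin n → ℚ) → ℚ
ΣΣ f = ΣFin (λ i → ΣFin (f i))

ΣFin-cong : ∀ {n} {f g : Fin n → ℚ} → (∀ k → f k ≡ g k) → ΣFin f ≡ ΣFin g
ΣFin-cong {zero}  f≗g = refl
ΣFin-cong {suc n} f≗g = cong₂ _+_ (f≗g Fin.zero) (ΣFin-cong (λ k → f≗g (Fin.suc k)))

ΣFin-≡0 : ∀ {n} {f : Fin n → ℚ} → (∀ k → f k ≡ 0ℚ) → ΣFin f ≡ 0ℚ
ΣFin-≡0 {zero}  f≗0 = refl
ΣFin-≡0 {suc n} f≗0 = cong₂ _+_ (f≗0 Fin.zero) (ΣFin-≡0 (λ k → f≗0 (Fin.suc k)))

ΣFin-distrib-+ : ∀ {n} (f g : Fin n → ℚ) → ΣFin (λ k → f k + g k) ≡ ΣFin f + ΣFin g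
ΣFin-distrib-+ {zero}  f g = refl
ΣFin-distrib-+ {suc n} f g = begin
  (f₀ + g₀) + ΣFin (λ k → f (Fin.suc k) + g (Fin.suc k))
    ≡⟨ cong ((f₀ + g₀) +_) (ΣFin-distrib-+ (λ k → f (Fin.suc k)) (λ k → g (Fin.suc k))) ⟩
  (f₀ + g₀) + (ΣFin (λ k → f (Fin.suc k)) + ΣFin (λ k → g (Fin.suc k)))
    ≡⟨ interchange f₀ g₀ _ _ ⟩
  (f₀ + ΣFin (λ k → f (Fin.suc k))) + (g₀ + ΣFin (λ k → g (Fin.suc k))) ∎
  where
  open ≡-Reasoning
  f₀ = f Fin.zero
  g₀ = g Fin.zero
  interchange : ∀ a b c d → (a + b) + (c + d) ≡ (a + c) + (b + d)
  interchange = Tactic.solve-∀ ℚ-ring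

ΣFin-*ˡ : ∀ {n} c (f : Fin n → ℚ) → ΣFin (λ k → c * f k) ≡ c * ΣFin f
ΣFin-*ˡ {zero}  c f = sym (ℚₚ.*-zeroʳ c)
ΣFin-*ˡ {suc n} c f = trans (cong (c * f Fin.zero +_) (ΣFin-*ˡ c (λ k → f (Fin.suc k))))
                            (sym (ℚₚ.*-distribˡ-+ c _ _))

ΣFin-comm : ∀ {m n} (f : Fin m → Fin n → ℚ) →
            ΣFin (λ i → ΣFin (λ j → f i j)) ≡ ΣFin (λ j → ΣFin (λ i → f i j))
ΣFin-comm {zero} {n} f = sym (ΣFin-≡0 {n} (λ _ → refl))
ΣFin-comm {suc m} f = trans (cong (ΣFin (f Fin.zero) +_) (ΣFin-comm (λ i → f (Fin.suc i))))
  (sym (ΣFin-distrib-+ (f Fin.zero) (λ j → ΣFin (λ i → f (Fin.suc i) j))))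

ΣFin-single : ∀ {n} (f : Fin n → ℚ) k₀ → (∀ k → k ≢ k₀ → f k ≡ 0ℚ) → ΣFin f ≡ f k₀
ΣFin-single {suc n} f Fin.zero f≗0 =
  trans (cong (f Fin.zero +_) (ΣFin-≡0 (λ k → f≗0 (Fin.suc k) (λ ()))))
        (ℚₚ.+-identityʳ _)
ΣFin-single {suc n} f (Fin.suc k₀) f≗0 =
  trans (cong₂ _+_ (f≗0 Fin.zero (λ ()))
                   (ΣFin-single (λ k → f (Fin.suc k)) k₀
                      (λ k k≢k₀ → f≗0 (Fin.suc k) (λ e → k≢k₀ (Finₚ.suc-injective e)))))
        (ℚₚ.+-identityˡ _)

ΣFin-nonneg : ∀ {n} (f : Fin n → ℚ) → (∀ k → 0ℚ ≤ℚ f k) → 0ℚ ≤ℚ ΣFin f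
ΣFin-nonneg {zero}  f f≥0 = ℚₚ.≤-refl
ΣFin-nonneg {suc n} f f≥0 =
  ℚₚ.+-mono-≤ (f≥0 Fin.zero) (ΣFin-nonneg (λ k → f (Fin.suc k)) (λ k → f≥0 (Fin.suc k)))

nonneg-+-≡0ˡ : ∀ {a b} → 0ℚ ≤ℚ a → 0ℚ ≤ℚ b → a + b ≡ 0ℚ → a ≡ 0ℚ
nonneg-+-≡0ˡ {a} {b} a≥0 b≥0 a+b≡0 = ℚₚ.≤-antisym a≤0 a≥0
  where
  a≤0 : a ≤ℚ 0ℚ
  a≤0 = subst₂ _≤ℚ_ (ℚₚ.+-identityʳ a) a+b≡0 (ℚₚ.+-monoʳ-≤ a b≥0)

nonneg-+-≡0ʳ : ∀ {a b} → 0ℚ ≤ℚ a → 0ℚ ≤ℚ b → a + b ≡ 0ℚ → b ≡ 0ℚ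
nonneg-+-≡0ʳ {a} {b} a≥0 b≥0 a+b≡0 = nonneg-+-≡0ˡ b≥0 a≥0 (trans (ℚₚ.+-comm b a) a+b≡0)

ΣFin-nonneg-≡0 : ∀ {n} (f : Fin n → ℚ) → (∀ k → 0ℚ ≤ℚ f k) → ΣFin f ≡ 0ℚ → ∀ k → f k ≡ 0ℚ
ΣFin-nonneg-≡0 {suc n} f f≥0 Σ≡0 Fin.zero =
  nonneg-+-≡0ˡ (f≥0 Fin.zero) (ΣFin-nonneg _ (λ k → f≥0 (Fin.suc k))) Σ≡0
ΣFin-nonneg-≡0 {suc n} f f≥0 Σ≡0 (Fin.suc k) =
  ΣFin-nonneg-≡0 (λ k → f (Fin.suc k)) (λ k → f≥0 (Fin.suc k))
    (nonneg-+-≡0ʳ (f≥0 Fin.zero) (ΣFin-nonneg _ (λ k → f≥0 (Fin.suc k))) Σ≡0) k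

ΣΣ-cong : ∀ {m n} {f g : Fin m → Fin n → ℚ} → (∀ i j → f i j ≡ g i j) → ΣΣ f ≡ ΣΣ g
ΣΣ-cong f≗g = ΣFin-cong (λ i → ΣFin-cong (f≗g i))

ΣΣ-≡0 : ∀ {m n} {f : Fin m → Fin n → ℚ} → (∀ i j → f i j ≡ 0ℚ) → ΣΣ f ≡ 0ℚ
ΣΣ-≡0 f≗0 = ΣFin-≡0 (λ i → ΣFin-≡0 (f≗0 i))

ΣΣ-distrib-+ : ∀ {m n} (f g : Fin m → Fin n → ℚ) →
               ΣΣ (λ i j → f i j + g i j) ≡ ΣΣ f + ΣΣ g
ΣΣ-distrib-+ f g = trans (ΣFin-cong (λ i → ΣFin-distrib-+ (f i) (g i)))
                         (ΣFin-distrib-+ (λ i → ΣFin (f i)) (λ i → ΣFin (g i)))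

ΣΣ-*ˡ : ∀ {m n} c (f : Fin m → Fin n → ℚ) → ΣΣ (λ i j → c * f i j) ≡ c * ΣΣ f
ΣΣ-*ˡ c f = trans (ΣFin-cong (λ i → ΣFin-*ˡ c (f i))) (ΣFin-*ˡ c (λ i → ΣFin (f i)))

ΣΣ-single : ∀ {m n} (f : Fin m → Fin n → ℚ) i₀ j₀ →
            (∀ i j → ¬ (i ≡ i₀ × j ≡ j₀) → f i j ≡ 0ℚ) → ΣΣ f ≡ f i₀ j₀
ΣΣ-single f i₀ j₀ f≗0 =
  trans (ΣFin-single _ i₀ (λ i i≢i₀ → ΣFin-≡0 (λ j → f≗0 i j (i≢i₀ ∘′ proj₁))))
        (ΣFin-single _ j₀ (λ j j≢j₀ → f≗0 i₀ j (j≢j₀ ∘′ proj₂)))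

δ : ∀ {n} → Fin n → Fin n → ℚ
δ i p = 𝟙 (toℕ i ≡ᵇ toℕ p)

δ-refl : ∀ {n} (i : Fin n) → δ i i ≡ 1ℚ
δ-refl i = cong 𝟙 (≡ᵇ-refl (toℕ i))

δ-≢ : ∀ {n} {i p : Fin n} → p ≢ i → δ i p ≡ 0ℚ
δ-≢ p≢i = cong 𝟙 (≢⇒≡ᵇ-false (λ e → p≢i (Finₚ.toℕ-injective (sym e))))

ΣFin-δ : ∀ {n} (f : Fin n → ℚ) i → ΣFin (λ p → δ i p * f p) ≡ f i
ΣFin-δ f i =
  trans (ΣFin-single _ i (λ p p≢i → trans (cong (_* f p) (δ-≢ p≢i)) (ℚₚ.*-zeroˡ (f p))))
        (trans (cong (_* f i) (δ-refl i)) (ℚₚ.*-identityˡ (f i)))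

ΣΣ-δ : ∀ {m n} (f : Fin m → Fin n → ℚ) i j → ΣΣ (λ p q → (δ i p * δ j q) * f p q) ≡ f i j
ΣΣ-δ f i j = begin
  ΣΣ (λ p q → (δ i p * δ j q) * f p q)
    ≡⟨ ΣΣ-cong (λ p q → ℚₚ.*-assoc (δ i p) (δ j q) (f p q)) ⟩
  ΣFin (λ p → ΣFin (λ q → δ i p * (δ j q * f p q)))
    ≡⟨ ΣFin-cong (λ p → ΣFin-*ˡ (δ i p) (λ q → δ j q * f p q)) ⟩
  ΣFin (λ p → δ i p * ΣFin (λ q → δ j q * f p q))
    ≡⟨ ΣFin-δ _ i ⟩
  ΣFin (λ q → δ j q * f i q)
    ≡⟨ ΣFin-δ _ j ⟩
  f i j ∎
  where open ≡-Reasoning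

sumℕ : ℕ → (ℕ → ℚ) → ℚ
sumℕ zero    g = 0ℚ
sumℕ (suc n) g = g 0 + sumℕ n (λ k → g (suc k))

ΣFin-toℕ : ∀ n (g : ℕ → ℚ) → ΣFin {n} (λ k → g (toℕ k)) ≡ sumℕ n g
ΣFin-toℕ zero    g = refl
ΣFin-toℕ (suc n) g = cong (g 0 +_) (ΣFin-toℕ n (λ k → g (suc k)))

sumℕ-≡0 : ∀ n (g : ℕ → ℚ) → (∀ k → g k ≡ 0ℚ) → sumℕ n g ≡ 0ℚ
sumℕ-≡0 zero    g g≗0 = refl
sumℕ-≡0 (suc n) g g≗0 = cong₂ _+_ (g≗0 0) (sumℕ-≡0 n _ (λ k → g≗0 (suc k)))

sumℕ-cong-< : ∀ n {f g : ℕ → ℚ} → (∀ k → k < n → f k ≡ g k) → sumℕ n f ≡ sumℕ n g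
sumℕ-cong-< zero    f≗g = refl
sumℕ-cong-< (suc n) f≗g =
  cong₂ _+_ (f≗g 0 (s≤s z≤n)) (sumℕ-cong-< n (λ k k<n → f≗g (suc k) (s≤s k<n)))

sumℕ-indicator : ∀ m (g : ℕ → ℚ) t → t < m → sumℕ m (λ s → 𝟙 (s ≡ᵇ t) * g s) ≡ g t
sumℕ-indicator (suc m) g zero    _ =
  trans (cong₂ _+_ (ℚₚ.*-identityˡ (g 0)) (sumℕ-≡0 m _ (λ s → ℚₚ.*-zeroˡ (g (suc s)))))
        (ℚₚ.+-identityʳ (g 0))
sumℕ-indicator (suc m) g (suc t) (s≤s t<m) =
  trans (cong₂ _+_ (ℚₚ.*-zeroˡ (g 0)) (sumℕ-indicator m (λ s → g (suc s)) t t<m))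
        (ℚₚ.+-identityˡ (g (suc t)))

data Direction : Set where
  row col diag anti : Direction

-- Anti-diagonals P - Q = const are indexed by P + n ∸ Q, which stays in ℕ for Q ≤ n.
key : ℕ → Direction → ℕ → ℕ → ℕ
key n row  P Q = P
key n col  P Q = Q
key n diag P Q = P ℕ.+ Q
key n anti P Q = P ℕ.+ n ∸ Q

ΣDir : (Direction → ℚ) → ℚ
ΣDir f = ((f row + f col) + f diag) + f anti

ΣDir-≡0 : ∀ {f : Direction → ℚ} → (∀ d → f d ≡ 0ℚ) → ΣDir f ≡ 0ℚ
ΣDir-≡0 f≗0 = cong₂ _+_ (cong₂ _+_ (cong₂ _+_ (f≗0 row) (f≗0 col)) (f≗0 diag)) (f≗0 anti)

fibreSum : ∀ {n} → (Fin n → Fin n → ℕ) → Vec² n → ℕ → ℚ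
fibreSum τ w t = ΣΣ (λ p q → 𝟙 (t ≡ᵇ τ p q) * w p q)

lineKey : ∀ {n} → Direction → Fin n → Fin n → ℕ
lineKey {n} d p q = key n d (toℕ p) (toℕ q)

lineSum : ∀ {n} → Direction → Vec² n → ℕ → ℚ
lineSum d = fibreSum (lineKey d)

lineSumsThrough : ∀ {n} → Vec² n → Fin n → Fin n → ℚ
lineSumsThrough w i j = ΣDir (λ d → lineSum d w (lineKey d i j))

ΣΣ-ΣDir : ∀ {m n} (f : Direction → Fin m → Fin n → ℚ) →
          ΣΣ (λ p q → ΣDir (λ d → f d p q)) ≡ ΣDir (λ d → ΣΣ (f d))
ΣΣ-ΣDir f =
  trans (ΣΣ-distrib-+ (λ p q → (f row p q + f col p q) + f diag p q) (f anti))
    (cong (_+ ΣΣ (f anti))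
      (trans (ΣΣ-distrib-+ (λ p q → f row p q + f col p q) (f diag))
        (cong (_+ ΣΣ (f diag)) (ΣΣ-distrib-+ (f row) (f col)))))

shifted-≡ : ∀ {X Y I J P Q c} → X ℕ.+ J ≡ I ℕ.+ c → Y ℕ.+ Q ≡ P ℕ.+ c →
            (X ≡ Y → I ℕ.+ Q ≡ P ℕ.+ J) × (I ℕ.+ Q ≡ P ℕ.+ J → X ≡ Y)
shifted-≡ {X} {Y} {I} {J} {P} {Q} {c} X+J≡I+c Y+Q≡P+c =
  (λ X≡Y → ℕₚ.+-cancelʳ-≡ c _ _ (trans (sym eqX) (trans (cong (ℕ._+ (J ℕ.+ Q)) X≡Y) eqY)))
  , (λ e → ℕₚ.+-cancelʳ-≡ (J ℕ.+ Q) X Y (trans eqX (trans (cong (ℕ._+ c) e) (sym eqY))))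
  where
  open ≡-Reasoning
  swap-last : ∀ a b c → (a ℕ.+ b) ℕ.+ c ≡ (a ℕ.+ c) ℕ.+ b
  swap-last = solve-∀
  eqX : X ℕ.+ (J ℕ.+ Q) ≡ (I ℕ.+ Q) ℕ.+ c
  eqX = begin
    X ℕ.+ (J ℕ.+ Q)   ≡⟨ sym (ℕₚ.+-assoc X J Q) ⟩
    (X ℕ.+ J) ℕ.+ Q   ≡⟨ cong (ℕ._+ Q) X+J≡I+c ⟩
    (I ℕ.+ c) ℕ.+ Q   ≡⟨ swap-last I c Q ⟩
    (I ℕ.+ Q) ℕ.+ c   ∎
  eqY : Y ℕ.+ (J ℕ.+ Q) ≡ (P ℕ.+ J) ℕ.+ c
  eqY = begin
    Y ℕ.+ (J ℕ.+ Q)   ≡⟨ cong (Y ℕ.+_) (ℕₚ.+-comm J Q) ⟩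
    Y ℕ.+ (Q ℕ.+ J)   ≡⟨ sym (ℕₚ.+-assoc Y Q J) ⟩
    (Y ℕ.+ Q) ℕ.+ J   ≡⟨ cong (ℕ._+ J) Y+Q≡P+c ⟩
    (P ℕ.+ c) ℕ.+ J   ≡⟨ swap-last P c J ⟩
    (P ℕ.+ J) ℕ.+ c   ∎

anti-key-≡ : ∀ n {I J P Q} → J ≤ n → Q ≤ n →
             (key n anti I J ≡ key n anti P Q → I ℕ.+ Q ≡ P ℕ.+ J) ×
             (I ℕ.+ Q ≡ P ℕ.+ J → key n anti I J ≡ key n anti P Q)
anti-key-≡ n {I} {J} {P} {Q} J≤n Q≤n =
  shifted-≡ (ℕₚ.m∸n+n≡m (ℕₚ.≤-trans J≤n (ℕₚ.m≤n+m n I)))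
            (ℕₚ.m∸n+n≡m (ℕₚ.≤-trans Q≤n (ℕₚ.m≤n+m n P)))

diagonals-meet-once : ∀ {I J P Q} → I ℕ.+ J ≡ P ℕ.+ Q → I ℕ.+ Q ≡ P ℕ.+ J → I ≡ P
diagonals-meet-once {I} {J} {P} {Q} e₁ e₂ =
  ℕₚ.*-cancelˡ-≡ I P 2 (ℕₚ.+-cancelʳ-≡ (J ℕ.+ Q) (2 ℕ.* I) (2 ℕ.* P) (begin
    2 ℕ.* I ℕ.+ (J ℕ.+ Q)            ≡⟨ regroup I J Q ⟩
    (I ℕ.+ J) ℕ.+ (I ℕ.+ Q)          ≡⟨ cong₂ ℕ._+_ e₁ e₂ ⟩
    (P ℕ.+ Q) ℕ.+ (P ℕ.+ J)          ≡⟨ sym (regroup P Q J) ⟩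
    2 ℕ.* P ℕ.+ (Q ℕ.+ J)            ≡⟨ cong (2 ℕ.* P ℕ.+_) (ℕₚ.+-comm Q J) ⟩
    2 ℕ.* P ℕ.+ (J ℕ.+ Q)            ∎))
  where
  open ≡-Reasoning
  regroup : ∀ a b c → 2 ℕ.* a ℕ.+ (b ℕ.+ c) ≡ (a ℕ.+ b) ℕ.+ (a ℕ.+ c)
  regroup = solve-∀

four : ℚ
four = ℤ.+ 4 / 1

-- Two distinct squares share at most one line; a square shares all four lines with itself.
adjacency-by-lines : ∀ I J P Q →
  𝟙 (not ((I ≡ᵇ P) ∧ (J ≡ᵇ Q)) ∧
     ((I ≡ᵇ P) ∨ (J ≡ᵇ Q) ∨ ((I ℕ.+ J) ≡ᵇ (P ℕ.+ Q)) ∨ ((I ℕ.+ Q) ≡ᵇ (P ℕ.+ J))))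
    + four * (𝟙 (I ≡ᵇ P) * 𝟙 (J ≡ᵇ Q))
  ≡ ((𝟙 (I ≡ᵇ P) + 𝟙 (J ≡ᵇ Q)) + 𝟙 ((I ℕ.+ J) ≡ᵇ (P ℕ.+ Q))) + 𝟙 ((I ℕ.+ Q) ≡ᵇ (P ℕ.+ J))
adjacency-by-lines I J P Q
  with I ≡ᵇ P | ≡ᵇ-reflects I P | J ≡ᵇ Q | ≡ᵇ-reflects J Q
     | (I ℕ.+ J) ≡ᵇ (P ℕ.+ Q) | ≡ᵇ-reflects (I ℕ.+ J) (P ℕ.+ Q)
     | (I ℕ.+ Q) ≡ᵇ (P ℕ.+ J) | ≡ᵇ-reflects (I ℕ.+ Q) (P ℕ.+ J)
... | true  | ofʸ refl | true  | ofʸ refl | true  | _      | true  | _      = refl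
... | true  | ofʸ refl | true  | ofʸ refl | false | ofⁿ ne | _     | _      = ⊥-elim (ne refl)
... | true  | ofʸ refl | true  | ofʸ refl | true  | _      | false | ofⁿ ne = ⊥-elim (ne refl)
... | true  | ofʸ refl | false | ofⁿ J≢Q | true  | ofʸ e  | _     | _      =
  ⊥-elim (J≢Q (ℕₚ.+-cancelˡ-≡ I J Q e))
... | true  | ofʸ refl | false | ofⁿ J≢Q | false | _      | true  | ofʸ e  =
  ⊥-elim (J≢Q (sym (ℕₚ.+-cancelˡ-≡ I Q J e)))
... | true  | _        | false | _        | false | _      | false | _      = refl
... | false | ofⁿ I≢P  | true  | ofʸ refl | true  | ofʸ e  | _     | _      =
  ⊥-elim (I≢P (ℕₚ.+-cancelʳ-≡ J I P e))
... | false | ofⁿ I≢P  | true  | ofʸ refl | false | _      | true  | ofʸ e  =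
  ⊥-elim (I≢P (ℕₚ.+-cancelʳ-≡ J I P e))
... | false | _        | true  | _        | false | _      | false | _      = refl
... | false | ofⁿ I≢P  | false | _        | true  | ofʸ e₁ | true  | ofʸ e₂ =
  ⊥-elim (I≢P (diagonals-meet-once e₁ e₂))
... | false | _        | false | _        | true  | _      | false | _      = refl
... | false | _        | false | _        | false | _      | true  | _      = refl
... | false | _        | false | _        | false | _      | false | _      = refl

adj-+-4δ : ∀ {n} (i j p q : Fin n) →
  adj i j p q + four * (δ i p * δ j q)
    ≡ ΣDir (λ d → 𝟙 (lineKey d i j ≡ᵇ lineKey d p q))
adj-+-4δ {n} i j p q =
  trans (adjacency-by-lines I J P Q)
        (cong (λ b → ((𝟙 (I ≡ᵇ P) + 𝟙 (J ≡ᵇ Q)) + 𝟙 ((I ℕ.+ J) ≡ᵇ (P ℕ.+ Q))) + 𝟙 b)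
              (≡ᵇ-respects-⇔ (proj₂ anti-lines) (proj₁ anti-lines)))
  where
  I = toℕ i
  J = toℕ j
  P = toℕ p
  Q = toℕ q
  anti-lines = anti-key-≡ n (ℕₚ.<⇒≤ (Finₚ.toℕ<n j)) (ℕₚ.<⇒≤ (Finₚ.toℕ<n q))

Q+4I≡lineSumsThrough : ∀ {n} (v : Vec² n) i j → applyQ v i j + four * v i j ≡ lineSumsThrough v i j
Q+4I≡lineSumsThrough v i j = begin
  applyQ v i j + four * v i j
    ≡⟨ cong (λ x → applyQ v i j + four * x) (sym (ΣΣ-δ v i j)) ⟩
  applyQ v i j + four * ΣΣ (λ p q → (δ i p * δ j q) * v p q)
    ≡⟨ cong (applyQ v i j +_) (sym (ΣΣ-*ˡ four (λ p q → (δ i p * δ j q) * v p q))) ⟩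
  applyQ v i j + ΣΣ (λ p q → four * ((δ i p * δ j q) * v p q))
    ≡⟨ sym (ΣΣ-distrib-+ (λ p q → adj i j p q * v p q)
                         (λ p q → four * ((δ i p * δ j q) * v p q))) ⟩
  ΣΣ (λ p q → adj i j p q * v p q + four * ((δ i p * δ j q) * v p q))
    ≡⟨ ΣΣ-cong (λ p q → distribute (adj i j p q) (δ i p * δ j q) (v p q)
                                 (λ d → 𝟙 (lineKey d i j ≡ᵇ lineKey d p q))
                                 (adj-+-4δ i j p q)) ⟩
  ΣΣ (λ p q → ΣDir (λ d → 𝟙 (lineKey d i j ≡ᵇ lineKey d p q) * v p q))
    ≡⟨ ΣΣ-ΣDir (λ d p q → 𝟙 (lineKey d i j ≡ᵇ lineKey d p q) * v p q) ⟩
  lineSumsThrough v i j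
    ∎
  where
  open ≡-Reasoning
  distribute : ∀ x y v (r : Direction → ℚ) → x + four * y ≡ ΣDir r →
               x * v + four * (y * v) ≡ ΣDir (λ d → r d * v)
  distribute x y v r e =
    trans (factor x four y v) (trans (cong (_* v) e) (expand (r row) (r col) (r diag) (r anti) v))
    where
    factor : ∀ x f y v → x * v + f * (y * v) ≡ (x + f * y) * v
    factor = Tactic.solve-∀ ℚ-ring
    expand : ∀ r c d a v → (((r + c) + d) + a) * v ≡ ((r * v + c * v) + d * v) + a * v
    expand = Tactic.solve-∀ ℚ-ring

eigenspace⇔lineSums≡0 : ∀ {n} (v : Vec² n) →
  InEigenspace n minus4 v ⇔ (∀ i j → lineSumsThrough v i j ≡ 0ℚ)
eigenspace⇔lineSums≡0 v = mk⇔
  (λ eigen i j → trans (sym (Q+4I≡lineSumsThrough v i j))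
                       (cancel (applyQ v i j) (v i j) (eigen i j)))
  (λ lines i j → isolate (applyQ v i j) (v i j) (trans (Q+4I≡lineSumsThrough v i j) (lines i j)))
  where
  cancel : ∀ x y → x ≡ minus4 * y → x + four * y ≡ 0ℚ
  cancel x y refl = negate-cancel y
    where
    negate-cancel : ∀ y → minus4 * y + four * y ≡ 0ℚ
    negate-cancel = Tactic.solve-∀ ℚ-ring
  isolate : ∀ x y → x + four * y ≡ 0ℚ → x ≡ minus4 * y
  isolate x y e = trans (shift x y) (trans (cong (_+ minus4 * y) e) (ℚₚ.+-identityˡ _))
    where
    shift : ∀ x y → x ≡ (x + four * y) + minus4 * y
    shift = Tactic.solve-∀ ℚ-ring

-- Eigenvectors have zero line sums

square-nonneg : ∀ x → 0ℚ ≤ℚ x * x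
square-nonneg x with ℚₚ.≤-total 0ℚ x
... | inj₁ x≥0 = ℚₚ.nonNegative⁻¹ (x * x)
  {{ℚₚ.nonNeg*nonNeg⇒nonNeg x {{ℚ.nonNegative x≥0}} x {{ℚ.nonNegative x≥0}}}}
... | inj₂ x≤0 = ℚₚ.nonNegative⁻¹ (x * x)
  {{ℚₚ.nonPos*nonPos⇒nonPos x {{ℚ.nonPositive x≤0}} x {{ℚ.nonPositive x≤0}}}}

square≡0⇒≡0 : ∀ x → x * x ≡ 0ℚ → x ≡ 0ℚ
square≡0⇒≡0 x x²≡0 with ℚₚ.<-cmp x 0ℚ
... | tri≈ _ x≡0 _ = x≡0
... | tri< x<0 _ _ = ⊥-elim (ℚₚ.<-irrefl (sym x²≡0) (ℚₚ.positive⁻¹ (x * x)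
  {{ℚₚ.neg*neg⇒pos x {{ℚ.negative x<0}} x {{ℚ.negative x<0}}}}))
... | tri> _ _ x>0 = ⊥-elim (ℚₚ.<-irrefl (sym x²≡0) (ℚₚ.positive⁻¹ (x * x)
  {{ℚₚ.pos*pos⇒pos x {{ℚ.positive x>0}} x {{ℚ.positive x>0}}}}))

ΣFin-fibreSum² : ∀ {n} m (τ : Fin n → Fin n → ℕ) (w : Vec² n) → (∀ p q → τ p q < m) →
  ΣFin {m} (λ s → fibreSum τ w (toℕ s) * fibreSum τ w (toℕ s))
    ≡ ΣΣ (λ p q → w p q * fibreSum τ w (τ p q))
ΣFin-fibreSum² {n} m τ w τ<m = begin
  ΣFin {m} (λ s → ℓ (toℕ s) * ΣΣ (λ p q → 𝟙 (toℕ s ≡ᵇ τ p q) * w p q))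
    ≡⟨ ΣFin-cong {m} (λ s → sym (ΣΣ-*ˡ (ℓ (toℕ s)) (λ p q → 𝟙 (toℕ s ≡ᵇ τ p q) * w p q))) ⟩
  ΣFin {m} (λ s → ΣFin {n} (λ p → ΣFin {n} (λ q → term (toℕ s) p q)))
    ≡⟨ ΣFin-comm {m} {n} (λ s p → ΣFin (term (toℕ s) p)) ⟩
  ΣFin {n} (λ p → ΣFin {m} (λ s → ΣFin {n} (λ q → term (toℕ s) p q)))
    ≡⟨ ΣFin-cong {n} (λ p → ΣFin-comm {m} {n} (λ s q → term (toℕ s) p q)) ⟩
  ΣΣ (λ p q → ΣFin {m} (λ s → term (toℕ s) p q))
    ≡⟨ ΣΣ-cong (λ p q → trans (ΣFin-toℕ m (λ s → term s p q)) (collapse p q)) ⟩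
  ΣΣ (λ p q → w p q * ℓ (τ p q))
    ∎
  where
  open ≡-Reasoning
  ℓ : ℕ → ℚ
  ℓ = fibreSum τ w
  term : ℕ → Fin n → Fin n → ℚ
  term s p q = ℓ s * (𝟙 (s ≡ᵇ τ p q) * w p q)
  reorder : ∀ x b y → x * (b * y) ≡ b * (y * x)
  reorder = Tactic.solve-∀ ℚ-ring
  collapse : ∀ p q → sumℕ m (λ s → term s p q) ≡ w p q * ℓ (τ p q)
  collapse p q = trans (sumℕ-cong-< m (λ s _ → reorder (ℓ s) (𝟙 (s ≡ᵇ τ p q)) (w p q)))
                       (sumℕ-indicator m (λ s → w p q * ℓ s) (τ p q) (τ<m p q))

fibreSum-beyond : ∀ {n} m (τ : Fin n → Fin n → ℕ) (w : Vec² n) → (∀ p q → τ p q < m) →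
                  ∀ t → m ≤ t → fibreSum τ w t ≡ 0ℚ
fibreSum-beyond m τ w τ<m t m≤t = ΣΣ-≡0 (λ p q →
  trans (cong (λ b → 𝟙 b * w p q) (≢⇒≡ᵇ-false (λ t≡τ → ℕₚ.<⇒≱ (τ<m p q) (subst (m ≤_) t≡τ m≤t))))
        (ℚₚ.*-zeroˡ (w p q)))

fibreSums≡0 : ∀ {n} m (τ : Fin n → Fin n → ℕ) (w : Vec² n) → (∀ p q → τ p q < m) →
              ΣFin {m} (λ s → fibreSum τ w (toℕ s) * fibreSum τ w (toℕ s)) ≡ 0ℚ →
              ∀ t → fibreSum τ w t ≡ 0ℚ
fibreSums≡0 m τ w τ<m Σℓ²≡0 t with t ℕ.<? m
... | no  t≮m = fibreSum-beyond m τ w τ<m t (ℕₚ.≮⇒≥ t≮m)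
... | yes t<m = subst (λ t → fibreSum τ w t ≡ 0ℚ) (Finₚ.toℕ-fromℕ< t<m)
  (square≡0⇒≡0 _ (ΣFin-nonneg-≡0 (λ s → fibreSum τ w (toℕ s) * fibreSum τ w (toℕ s))
                                  (λ s → square-nonneg (fibreSum τ w (toℕ s))) Σℓ²≡0 (fromℕ< t<m)))

ΣDir-nonneg-≡0 : ∀ (f : Direction → ℚ) → (∀ d → 0ℚ ≤ℚ f d) → ΣDir f ≡ 0ℚ → ∀ d → f d ≡ 0ℚ
ΣDir-nonneg-≡0 f f≥0 Σ≡0 = λ
  { row  → nonneg-+-≡0ˡ (f≥0 row) (f≥0 col) rc≡0
  ; col  → nonneg-+-≡0ʳ (f≥0 row) (f≥0 col) rc≡0
  ; diag → nonneg-+-≡0ʳ rc≥0 (f≥0 diag) rcd≡0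
  ; anti → nonneg-+-≡0ʳ rcd≥0 (f≥0 anti) Σ≡0 }
  where
  rc≥0  = ℚₚ.+-mono-≤ (f≥0 row) (f≥0 col)
  rcd≥0 = ℚₚ.+-mono-≤ rc≥0 (f≥0 diag)
  rcd≡0 = nonneg-+-≡0ˡ rcd≥0 (f≥0 anti) Σ≡0
  rc≡0  = nonneg-+-≡0ˡ rc≥0 (f≥0 diag) rcd≡0

ZeroLineSums : ∀ {n} → Vec² n → Set
ZeroLineSums w = ∀ d t → lineSum d w t ≡ 0ℚ

lineKey<2n : ∀ {n} d (p q : Fin n) → lineKey d p q < n ℕ.+ n
lineKey<2n {n} row  p q = ℕₚ.<-≤-trans (Finₚ.toℕ<n p) (ℕₚ.m≤m+n n n)
lineKey<2n {n} col  p q = ℕₚ.<-≤-trans (Finₚ.toℕ<n q) (ℕₚ.m≤m+n n n)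
lineKey<2n {n} diag p q = ℕₚ.+-mono-< (Finₚ.toℕ<n p) (Finₚ.toℕ<n q)
lineKey<2n {n} anti p q =
  ℕₚ.≤-<-trans (ℕₚ.m∸n≤m (toℕ p ℕ.+ n) (toℕ q)) (ℕₚ.+-monoˡ-< n (Finₚ.toℕ<n p))

-- ⟨w, (Q + 4I) w⟩ is the sum of the squares of all line sums of w.
lineSumsThrough≡0⇒ZeroLineSums : ∀ {n} (w : Vec² n) →
  (∀ i j → lineSumsThrough w i j ≡ 0ℚ) → ZeroLineSums w
lineSumsThrough≡0⇒ZeroLineSums {n} w through≡0 d =
  fibreSums≡0 (n ℕ.+ n) (lineKey d) w (lineKey<2n d)
    (ΣDir-nonneg-≡0 squares
       (λ d → ΣFin-nonneg {n ℕ.+ n} _ (λ s → square-nonneg (lineSum d w (toℕ s))))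
       squares≡0 d)
  where
  squares : Direction → ℚ
  squares d = ΣFin {n ℕ.+ n} (λ s → lineSum d w (toℕ s) * lineSum d w (toℕ s))
  distribute : ∀ x (f : Direction → ℚ) → x * ΣDir f ≡ ΣDir (λ d → x * f d)
  distribute x f = expand x (f row) (f col) (f diag) (f anti)
    where
    expand : ∀ x a b c d → x * (((a + b) + c) + d) ≡ ((x * a + x * b) + x * c) + x * d
    expand = Tactic.solve-∀ ℚ-ring
  squares≡0 : ΣDir squares ≡ 0ℚ
  squares≡0 = begin
    ΣDir squares
      ≡⟨ cong₂ _+_ (cong₂ _+_ (cong₂ _+_ (sq row) (sq col)) (sq diag)) (sq anti) ⟩
    ΣDir (λ d → ΣΣ (λ p q → w p q * lineSum d w (lineKey d p q)))
      ≡⟨ sym (ΣΣ-ΣDir (λ d p q → w p q * lineSum d w (lineKey d p q))) ⟩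
    ΣΣ (λ p q → ΣDir (λ d → w p q * lineSum d w (lineKey d p q)))
      ≡⟨ ΣΣ-cong (λ p q → sym (distribute (w p q) (λ d → lineSum d w (lineKey d p q)))) ⟩
    ΣΣ (λ p q → w p q * lineSumsThrough w p q)
      ≡⟨ ΣΣ-≡0 (λ p q → trans (cong (w p q *_) (through≡0 p q)) (ℚₚ.*-zeroʳ (w p q))) ⟩
    0ℚ ∎
    where
    open ≡-Reasoning
    sq : ∀ d → squares d ≡ ΣΣ (λ p q → w p q * lineSum d w (lineKey d p q))
    sq d = ΣFin-fibreSum² (n ℕ.+ n) (lineKey d) w (lineKey<2n d)

eigenspace⇔ZeroLineSums : ∀ {n} (v : Vec² n) → InEigenspace n minus4 v ⇔ ZeroLineSums v
eigenspace⇔ZeroLineSums v = mk⇔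
  (λ eigen → lineSumsThrough≡0⇒ZeroLineSums v (Equivalence.to (eigenspace⇔lineSums≡0 v) eigen))
  (λ zero-lines → Equivalence.from (eigenspace⇔lineSums≡0 v)
                    (λ i j → ΣDir-≡0 (λ d → zero-lines d (lineKey d i j))))

sumℕ-window : ∀ A n (g : ℕ → ℚ) → 4 ℕ.+ A ≤ n →
              (∀ P → P < A → g P ≡ 0ℚ) → (∀ P → 4 ℕ.+ A ≤ P → g P ≡ 0ℚ) →
              sumℕ n g ≡ sumℕ 4 (λ k → g (k ℕ.+ A))
sumℕ-window zero (suc (suc (suc (suc m)))) g (s≤s (s≤s (s≤s (s≤s _)))) _ beyond =
  cong (λ x → g 0 + (g 1 + (g 2 + (g 3 + x))))
       (sumℕ-≡0 m _ (λ k → beyond (4 ℕ.+ k) (s≤s (s≤s (s≤s (s≤s z≤n))))))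
sumℕ-window (suc A) (suc n) g (s≤s 4+A≤n) before beyond =
  trans (cong (_+ sumℕ n (λ k → g (suc k))) (before 0 (s≤s z≤n)))
   (trans (ℚₚ.+-identityˡ _)
     (sumℕ-window A n (λ k → g (suc k)) 4+A≤n
        (λ P P<A → before (suc P) (s≤s P<A)) (λ P 4+A≤P → beyond (suc P) (s≤s 4+A≤P))))

block : (ℕ → ℕ → ℚ) → ℚ
block h = sumℕ 4 (λ k → sumℕ 4 (h k))

block-cong : ∀ {g h : ℕ → ℕ → ℚ} → (∀ k l → k < 4 → l < 4 → g k l ≡ h k l) → block g ≡ block h
block-cong g≗h = sumℕ-cong-< 4 (λ k k<4 → sumℕ-cong-< 4 (λ l l<4 → g≗h k l k<4 l<4))

X4-pairing : ∀ (g : ℕ → ℕ → ℚ) → block (λ k l → g k l * X4 k l)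
           ≡ ((g 0 1 - g 0 2) + (g 1 3 - g 1 0)) + ((g 2 0 - g 2 3) + (g 3 2 - g 3 1))
X4-pairing g = expand (g 0 0) (g 0 1) (g 0 2) (g 0 3) (g 1 0) (g 1 1) (g 1 2) (g 1 3)
                      (g 2 0) (g 2 1) (g 2 2) (g 2 3) (g 3 0) (g 3 1) (g 3 2) (g 3 3)
  where
  expand : ∀ x00 x01 x02 x03 x10 x11 x12 x13 x20 x21 x22 x23 x30 x31 x32 x33 →
      (x00 * X4 0 0 + (x01 * X4 0 1 + (x02 * X4 0 2 + (x03 * X4 0 3 + 0ℚ))))
    + ((x10 * X4 1 0 + (x11 * X4 1 1 + (x12 * X4 1 2 + (x13 * X4 1 3 + 0ℚ))))
    + ((x20 * X4 2 0 + (x21 * X4 2 1 + (x22 * X4 2 2 + (x23 * X4 2 3 + 0ℚ))))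
    + ((x30 * X4 3 0 + (x31 * X4 3 1 + (x32 * X4 3 2 + (x33 * X4 3 3 + 0ℚ)))) + 0ℚ)))
    ≡ ((x01 - x02) + (x13 - x10)) + ((x20 - x23) + (x32 - x31))
  expand = Tactic.solve-∀ ℚ-ring

X4-at : ℕ → ℕ → ℕ → ℕ → ℚ
X4-at A B P Q = if (A ≤ᵇ P) ∧ (B ≤ᵇ Q) then X4 (P ∸ A) (Q ∸ B) else 0ℚ

X4-rows≥4 : ∀ k l → 4 ≤ k → X4 k l ≡ 0ℚ
X4-rows≥4 k l (s≤s (s≤s (s≤s (s≤s _)))) = refl

X4-cols≥4 : ∀ k l → 4 ≤ l → X4 k l ≡ 0ℚ
X4-cols≥4 0 l (s≤s (s≤s (s≤s (s≤s _)))) = refl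
X4-cols≥4 1 l (s≤s (s≤s (s≤s (s≤s _)))) = refl
X4-cols≥4 2 l (s≤s (s≤s (s≤s (s≤s _)))) = refl
X4-cols≥4 3 l (s≤s (s≤s (s≤s (s≤s _)))) = refl
X4-cols≥4 (suc (suc (suc (suc k)))) l _  = refl

X4-at-above : ∀ A B P Q → P < A → X4-at A B P Q ≡ 0ℚ
X4-at-above A B P Q P<A rewrite ≤ᵇ-false {A} {P} P<A = refl

X4-at-left : ∀ A B P Q → Q < B → X4-at A B P Q ≡ 0ℚ
X4-at-left A B P Q Q<B rewrite ≤ᵇ-false {B} {Q} Q<B | ∧-zeroʳ (A ≤ᵇ P) = refl

X4-at-below : ∀ A B P Q → 4 ℕ.+ A ≤ P → X4-at A B P Q ≡ 0ℚ
X4-at-below A B P Q 4+A≤P with (A ≤ᵇ P) ∧ (B ≤ᵇ Q)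
... | false = refl
... | true  = X4-rows≥4 (P ∸ A) (Q ∸ B) (ℕₚ.m+n≤o⇒m≤o∸n 4 4+A≤P)

X4-at-right : ∀ A B P Q → 4 ℕ.+ B ≤ Q → X4-at A B P Q ≡ 0ℚ
X4-at-right A B P Q 4+B≤Q with (A ≤ᵇ P) ∧ (B ≤ᵇ Q)
... | false = refl
... | true  = X4-cols≥4 (P ∸ A) (Q ∸ B) (ℕₚ.m+n≤o⇒m≤o∸n 4 4+B≤Q)

X4-at-shift : ∀ A B k l → X4-at A B (k ℕ.+ A) (l ℕ.+ B) ≡ X4 k l
X4-at-shift A B k l
  rewrite ≤ᵇ-true (ℕₚ.m≤n+m A k) | ≤ᵇ-true (ℕₚ.m≤n+m B l)
        | ℕₚ.m+n∸n≡m k A | ℕₚ.m+n∸n≡m l B = refl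

ΣΣ-*-X4-at≡block : ∀ n A B (g : ℕ → ℕ → ℚ) → 4 ℕ.+ A ≤ n → 4 ℕ.+ B ≤ n →
  ΣΣ {n} {n} (λ p q → g (toℕ p) (toℕ q) * X4-at A B (toℕ p) (toℕ q))
    ≡ block (λ k l → g (k ℕ.+ A) (l ℕ.+ B) * X4 k l)
ΣΣ-*-X4-at≡block n A B g 4+A≤n 4+B≤n = begin
  ΣΣ {n} {n} (λ p q → h (toℕ p) (toℕ q))
    ≡⟨ ΣFin-cong {n} (λ p → ΣFin-toℕ n (h (toℕ p))) ⟩
  ΣFin {n} (λ p → sumℕ n (h (toℕ p)))
    ≡⟨ ΣFin-toℕ n (λ P → sumℕ n (h P)) ⟩
  sumℕ n (λ P → sumℕ n (h P))
    ≡⟨ sumℕ-window A n (λ P → sumℕ n (h P)) 4+A≤n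
         (λ P P<A → sumℕ-≡0 n _ (λ Q → zeroʳ (g P Q) (X4-at-above A B P Q P<A)))
         (λ P 4+A≤P → sumℕ-≡0 n _ (λ Q → zeroʳ (g P Q) (X4-at-below A B P Q 4+A≤P))) ⟩
  sumℕ 4 (λ k → sumℕ n (h (k ℕ.+ A)))
    ≡⟨ sumℕ-cong-< 4 (λ k _ → sumℕ-window B n (h (k ℕ.+ A)) 4+B≤n
                       (λ Q Q<B → zeroʳ (g (k ℕ.+ A) Q) (X4-at-left A B (k ℕ.+ A) Q Q<B))
                       (λ Q 4+B≤Q → zeroʳ (g (k ℕ.+ A) Q) (X4-at-right A B (k ℕ.+ A) Q 4+B≤Q))) ⟩
  block (λ k l → h (k ℕ.+ A) (l ℕ.+ B))
    ≡⟨ block-cong (λ k l _ _ → cong (g (k ℕ.+ A) (l ℕ.+ B) *_) (X4-at-shift A B k l)) ⟩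
  block (λ k l → g (k ℕ.+ A) (l ℕ.+ B) * X4 k l)
    ∎
  where
  open ≡-Reasoning
  h : ℕ → ℕ → ℚ
  h P Q = g P Q * X4-at A B P Q
  zeroʳ : ∀ x {y} → y ≡ 0ℚ → x * y ≡ 0ℚ
  zeroʳ x refl = ℚₚ.*-zeroʳ x

X4-rows : ∀ (g : ℕ → ℚ) → block (λ k l → g k * X4 k l) ≡ 0ℚ
X4-rows g = trans (X4-pairing (λ k l → g k)) (cancel (g 0) (g 1) (g 2) (g 3))
  where
  cancel : ∀ a b c d → ((a - a) + (b - b)) + ((c - c) + (d - d)) ≡ 0ℚ
  cancel = Tactic.solve-∀ ℚ-ring

X4-cols : ∀ (g : ℕ → ℚ) → block (λ k l → g l * X4 k l) ≡ 0ℚ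
X4-cols g = trans (X4-pairing (λ k l → g l)) (cancel (g 0) (g 1) (g 2) (g 3))
  where
  cancel : ∀ a b c d → ((b - c) + (d - a)) + ((a - d) + (c - b)) ≡ 0ℚ
  cancel = Tactic.solve-∀ ℚ-ring

X4-diags : ∀ (g : ℕ → ℚ) → block (λ k l → g (k ℕ.+ l) * X4 k l) ≡ 0ℚ
X4-diags g = trans (X4-pairing (λ k l → g (k ℕ.+ l))) (cancel (g 1) (g 2) (g 4) (g 5))
  where
  cancel : ∀ a b c d → ((a - b) + (c - a)) + ((b - d) + (d - c)) ≡ 0ℚ
  cancel = Tactic.solve-∀ ℚ-ring

-- The anti-diagonal l - k = y - x, stated without subtraction so that ≡ᵇ computes on literals k, l.
X4-antidiags : ∀ x y → block (λ k l → 𝟙 ((l ℕ.+ x) ≡ᵇ (k ℕ.+ y)) * X4 k l) ≡ 0ℚ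
X4-antidiags x y =
  trans (X4-pairing (λ k l → 𝟙 ((l ℕ.+ x) ≡ᵇ (k ℕ.+ y))))
        (cancel (𝟙 (suc x ≡ᵇ y)) (𝟙 (suc (suc x) ≡ᵇ y)) (𝟙 (x ≡ᵇ suc y)) (𝟙 (x ≡ᵇ suc (suc y))))
  where
  cancel : ∀ a b c d → ((a - b) + (b - c)) + ((d - a) + (c - d)) ≡ 0ℚ
  cancel = Tactic.solve-∀ ℚ-ring

≡ᵇ-∸ : ∀ {t X Y} → Y ≤ X → (t ≡ᵇ X ∸ Y) ≡ ((t ℕ.+ Y) ≡ᵇ X)
≡ᵇ-∸ {t} {X} {Y} Y≤X = ≡ᵇ-respects-⇔
  (λ t≡X∸Y → trans (cong (ℕ._+ Y) t≡X∸Y) (ℕₚ.m∸n+n≡m Y≤X))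
  (λ t+Y≡X → trans (sym (ℕₚ.m+n∸n≡m t Y)) (cong (ℕ._∸ Y) t+Y≡X))

X-lineSum≡0 : ∀ N (a b : Fin N) d t → lineSum d (Xn (3 ℕ.+ N) a b) t ≡ 0ℚ
X-lineSum≡0 N a b d t =
  trans (ΣΣ-*-X4-at≡block n A B (λ P Q → 𝟙 (t ≡ᵇ key n d P Q)) (fits a) (fits b)) (on-block d)
  where
  n = 3 ℕ.+ N
  A = toℕ a
  B = toℕ b
  fits : (c : Fin N) → 4 ℕ.+ toℕ c ≤ n
  fits c = s≤s (s≤s (s≤s (Finₚ.toℕ<n c)))
  on-block : ∀ d → block (λ k l → 𝟙 (t ≡ᵇ key n d (k ℕ.+ A) (l ℕ.+ B)) * X4 k l) ≡ 0ℚ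
  on-block row  = X4-rows (λ k → 𝟙 (t ≡ᵇ k ℕ.+ A))
  on-block col  = X4-cols (λ l → 𝟙 (t ≡ᵇ l ℕ.+ B))
  on-block diag =
    trans (block-cong (λ k l _ _ → cong (λ s → 𝟙 (t ≡ᵇ s) * X4 k l) (regroup k A l B)))
          (X4-diags (λ s → 𝟙 (t ≡ᵇ s ℕ.+ (A ℕ.+ B))))
    where
    regroup : ∀ k A l B → (k ℕ.+ A) ℕ.+ (l ℕ.+ B) ≡ (k ℕ.+ l) ℕ.+ (A ℕ.+ B)
    regroup = solve-∀
  on-block anti =
    trans (block-cong (λ k l _ l<4 → cong (λ b → 𝟙 b * X4 k l)
            (trans (≡ᵇ-∸ {t} (bound k l l<4))
                   (cong₂ _≡ᵇ_ (regroupˡ t l B) (ℕₚ.+-assoc k A n)))))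
          (X4-antidiags (t ℕ.+ B) (A ℕ.+ n))
    where
    regroupˡ : ∀ t l B → t ℕ.+ (l ℕ.+ B) ≡ l ℕ.+ (t ℕ.+ B)
    regroupˡ = solve-∀
    bound : ∀ k l → l < 4 → l ℕ.+ B ≤ (k ℕ.+ A) ℕ.+ n
    bound k l l<4 = ℕₚ.≤-trans (ℕₚ.≤-trans (ℕₚ.+-monoˡ-≤ B (ℕₚ.<⇒≤ l<4)) (fits b))
                               (ℕₚ.m≤n+m n (k ℕ.+ A))

X-eigenvector : ∀ N (a b : Fin N) → InEigenspace (3 ℕ.+ N) minus4 (Xn (3 ℕ.+ N) a b)
X-eigenvector N a b =
  Equivalence.from (eigenspace⇔ZeroLineSums (Xn (3 ℕ.+ N) a b)) (X-lineSum≡0 N a b)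

-- Pivots and linear independence

_<ₗₑₓ_ : ℕ × ℕ → ℕ × ℕ → Set
_<ₗₑₓ_ = ×-Lex _≡_ _<_ _<_

<ₗₑₓ-compare : Trichotomous (Pointwise _≡_ _≡_) _<ₗₑₓ_
<ₗₑₓ-compare = ×-compare sym ℕₚ.<-cmp ℕₚ.<-cmp

<ₗₑₓ-origin : ∀ {x y} → ¬ (x , y) <ₗₑₓ (0 , 0)
<ₗₑₓ-origin (inj₁ ())
<ₗₑₓ-origin (inj₂ (_ , ()))

<ₗₑₓ-suc : ∀ {x y a b} → (x , y) <ₗₑₓ (a , suc b) → (x , y) <ₗₑₓ (a , b) ⊎ (x ≡ a × y ≡ b)
<ₗₑₓ-suc (inj₁ x<a) = inj₁ (inj₁ x<a)
<ₗₑₓ-suc {y = y} {b = b} (inj₂ (x≡a , y<1+b)) with y ℕ.≟ b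
... | yes y≡b = inj₂ (x≡a , y≡b)
... | no  y≢b = inj₁ (inj₂ (x≡a , ℕₚ.≤∧≢⇒< (ℕₚ.≤-pred y<1+b) y≢b))

<ₗₑₓ-next-row : ∀ {N x y a} → (x , y) <ₗₑₓ (suc a , 0) → y < N → (x , y) <ₗₑₓ (a , N)
<ₗₑₓ-next-row {x = x} {a = a} (inj₁ x<1+a) y<N with x ℕ.≟ a
... | yes x≡a = inj₂ (x≡a , y<N)
... | no  x≢a = inj₁ (ℕₚ.≤∧≢⇒< (ℕₚ.≤-pred x<1+a) x≢a)

lex-induction : ∀ N (P : ℕ → ℕ → Set) → P 0 0 →
  (∀ (a b : Fin N) → P (toℕ a) (toℕ b) → P (toℕ a) (suc (toℕ b))) →
  (∀ x → P x N → P (suc x) 0) → P N 0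
lex-induction N P start step next-row = rows N ℕₚ.≤-refl
  where
  along-row : ∀ x → x < N → P x 0 → ∀ y → y ≤ N → P x y
  along-row x x<N P₀ zero    _     = P₀
  along-row x x<N P₀ (suc y) 1+y≤N =
    subst₂ (λ x y → P x (suc y)) (Finₚ.toℕ-fromℕ< x<N) (Finₚ.toℕ-fromℕ< 1+y≤N)
      (step (fromℕ< x<N) (fromℕ< 1+y≤N)
        (subst₂ P (sym (Finₚ.toℕ-fromℕ< x<N)) (sym (Finₚ.toℕ-fromℕ< 1+y≤N))
          (along-row x x<N P₀ y (ℕₚ.<⇒≤ 1+y≤N))))
  rows : ∀ x → x ≤ N → P x 0
  rows zero    _     = start
  rows (suc x) 1+x≤N = next-row x (along-row x 1+x≤N (rows x (ℕₚ.<⇒≤ 1+x≤N)) N ℕₚ.≤-refl)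

X4-at-pivot : ∀ A B → X4-at A B A (suc B) ≡ 1ℚ
X4-at-pivot A B = X4-at-shift A B 0 1

X4-at-earlier-pivot : ∀ {a b A B} → (a , b) <ₗₑₓ (A , B) → X4-at A B a (suc b) ≡ 0ℚ
X4-at-earlier-pivot {a} {b} {A} {B} (inj₁ a<A) = X4-at-above A B a (suc b) a<A
X4-at-earlier-pivot {a} {b} {A} {B} (inj₂ (refl , b<B)) with suc b ℕ.≟ B
... | yes refl   = X4-at-shift a (suc b) 0 0
... | no  1+b≢B = X4-at-left a B a (suc b) (ℕₚ.≤∧≢⇒< b<B 1+b≢B)

-- The pivot of X^{(a,b)} is the square (a, b+1), where it has the entry [X₄]₁₂ = 1.
pivot-row : ∀ {N} → Fin N → Fin (3 ℕ.+ N)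
pivot-row {N} a = Fin.inject≤ a (ℕₚ.m≤n+m N 3)

pivot-col : ∀ {N} → Fin N → Fin (3 ℕ.+ N)
pivot-col {N} b = Fin.suc (Fin.inject≤ b (ℕₚ.m≤n+m N 2))

X-at-pivot : ∀ {N} (a' b' a b : Fin N) →
  Xn (3 ℕ.+ N) a' b' (pivot-row a) (pivot-col b) ≡ X4-at (toℕ a') (toℕ b') (toℕ a) (suc (toℕ b))
X-at-pivot {N} a' b' a b
  rewrite Finₚ.toℕ-inject≤ a (ℕₚ.m≤n+m N 3) | Finₚ.toℕ-inject≤ b (ℕₚ.m≤n+m N 2) = refl

combX-at-pivot : ∀ {N} (c : Fin N → Fin N → ℚ) (a b : Fin N) →
  (∀ a' b' → (toℕ a' , toℕ b') <ₗₑₓ (toℕ a , toℕ b) → c a' b' ≡ 0ℚ) →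
  combX (3 ℕ.+ N) c (pivot-row a) (pivot-col b) ≡ c a b
combX-at-pivot {N} c a b earlier≡0 = begin
  ΣΣ (λ a' b' → c a' b' * X a' b')
    ≡⟨ ΣΣ-single _ a b others ⟩
  c a b * X a b
    ≡⟨ cong (c a b *_) (trans (X-at-pivot a b a b) (X4-at-pivot (toℕ a) (toℕ b))) ⟩
  c a b * 1ℚ
    ≡⟨ ℚₚ.*-identityʳ (c a b) ⟩
  c a b ∎
  where
  open ≡-Reasoning
  X : Fin N → Fin N → ℚ
  X a' b' = Xn (3 ℕ.+ N) a' b' (pivot-row a) (pivot-col b)
  others : ∀ a' b' → ¬ (a' ≡ a × b' ≡ b) → c a' b' * X a' b' ≡ 0ℚ
  others a' b' ≢ab with <ₗₑₓ-compare (toℕ a' , toℕ b') (toℕ a , toℕ b)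
  ... | tri< before _ _ =
    trans (cong (_* X a' b') (earlier≡0 a' b' before)) (ℚₚ.*-zeroˡ (X a' b'))
  ... | tri≈ _ (a'≡a , b'≡b) _ =
    ⊥-elim (≢ab (Finₚ.toℕ-injective a'≡a , Finₚ.toℕ-injective b'≡b))
  ... | tri> _ _ after =
    trans (cong (c a' b' *_) (trans (X-at-pivot a' b' a b) (X4-at-earlier-pivot after)))
          (ℚₚ.*-zeroʳ (c a' b'))

combX-injective : ∀ N (c : Fin N → Fin N → ℚ) → (∀ i j → combX (3 ℕ.+ N) c i j ≡ 0ℚ) →
                  ∀ a b → c a b ≡ 0ℚ
combX-injective N c combX≡0 a b =
  lex-induction N Earlier≡0 (λ _ _ → ⊥-elim ∘′ <ₗₑₓ-origin) step next-row
    a b (inj₁ (Finₚ.toℕ<n a))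
  where
  Earlier≡0 : ℕ → ℕ → Set
  Earlier≡0 x y = ∀ a b → (toℕ a , toℕ b) <ₗₑₓ (x , y) → c a b ≡ 0ℚ
  step : ∀ a b → Earlier≡0 (toℕ a) (toℕ b) → Earlier≡0 (toℕ a) (suc (toℕ b))
  step a b earlier≡0 a' b' before with <ₗₑₓ-suc before
  ... | inj₁ before' = earlier≡0 a' b' before'
  ... | inj₂ (a'≡a , b'≡b) rewrite Finₚ.toℕ-injective a'≡a | Finₚ.toℕ-injective b'≡b =
    trans (sym (combX-at-pivot c a b earlier≡0)) (combX≡0 (pivot-row a) (pivot-col b))
  next-row : ∀ x → Earlier≡0 x N → Earlier≡0 (suc x) 0
  next-row x earlier≡0 a b before = earlier≡0 a b (<ₗₑₓ-next-row before (Finₚ.toℕ<n b))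

-- Vectors with zero line sums that vanish at the pivots

fibre-singleton : ∀ {n} (τ : Fin n → Fin n → ℕ) (w : Vec² n) p₀ q₀ →
  fibreSum τ w (τ p₀ q₀) ≡ 0ℚ →
  (∀ p q → τ p q ≡ τ p₀ q₀ → ¬ (p ≡ p₀ × q ≡ q₀) → w p q ≡ 0ℚ) → w p₀ q₀ ≡ 0ℚ
fibre-singleton τ w p₀ q₀ fibre≡0 others≡0 = begin
  w p₀ q₀                              ≡⟨ sym (ℚₚ.*-identityˡ (w p₀ q₀)) ⟩
  1ℚ * w p₀ q₀                         ≡⟨ cong (λ b → 𝟙 b * w p₀ q₀) (sym (≡ᵇ-refl (τ p₀ q₀))) ⟩
  𝟙 (τ p₀ q₀ ≡ᵇ τ p₀ q₀) * w p₀ q₀     ≡⟨ sym (ΣΣ-single _ p₀ q₀ off-cell) ⟩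
  fibreSum τ w (τ p₀ q₀)               ≡⟨ fibre≡0 ⟩
  0ℚ                                   ∎
  where
  open ≡-Reasoning
  off-cell : ∀ p q → ¬ (p ≡ p₀ × q ≡ q₀) → 𝟙 (τ p₀ q₀ ≡ᵇ τ p q) * w p q ≡ 0ℚ
  off-cell p q ≢cell with τ p₀ q₀ ≡ᵇ τ p q | ≡ᵇ-reflects (τ p₀ q₀) (τ p q)
  ... | true  | ofʸ e = trans (ℚₚ.*-identityˡ (w p q)) (others≡0 p q (sym e) ≢cell)
  ... | false | _     = ℚₚ.*-zeroˡ (w p q)

position : ∀ N X → X < 3 ℕ.+ N → X < N ⊎ X ≡ N ⊎ X ≡ suc N ⊎ X ≡ suc (suc N)
position zero    0       _ = inj₂ (inj₁ refl)
position zero    1       _ = inj₂ (inj₂ (inj₁ refl))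
position zero    2       _ = inj₂ (inj₂ (inj₂ refl))
position zero    (suc (suc (suc X))) (s≤s (s≤s (s≤s ())))
position (suc N) zero    _ = inj₁ (s≤s z≤n)
position (suc N) (suc X) (s≤s X<3+N) with position N X X<3+N
... | inj₁ X<N                = inj₁ (s≤s X<N)
... | inj₂ (inj₁ X≡N)         = inj₂ (inj₁ (cong suc X≡N))
... | inj₂ (inj₂ (inj₁ X≡N+1)) = inj₂ (inj₂ (inj₁ (cong suc X≡N+1)))
... | inj₂ (inj₂ (inj₂ X≡N+2)) = inj₂ (inj₂ (inj₂ (cong suc X≡N+2)))

+-balance-≤ : ∀ {a b c d} → a ℕ.+ c ≡ b ℕ.+ d → d ≤ c → a ≤ b
+-balance-≤ {a} {b} {c} {d} a+c≡b+d d≤c =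
  ℕₚ.+-cancelʳ-≤ c a b (subst (ℕ._≤ b ℕ.+ c) (sym a+c≡b+d) (ℕₚ.+-monoʳ-≤ b d≤c))

+-balance-≡ : ∀ {a b c d} → a ℕ.+ c ≡ b ℕ.+ d → a ≡ b → c ≡ d
+-balance-≡ {a} a+c≡a+d refl = ℕₚ.+-cancelˡ-≡ a _ _ a+c≡a+d

pivot-cell : ∀ {N} (w : Vec² (3 ℕ.+ N)) p q → toℕ p < N → ∀ {Q} → Q < N → toℕ q ≡ suc Q →
  (∀ a b → w (pivot-row a) (pivot-col b) ≡ 0ℚ) → w p q ≡ 0ℚ
pivot-cell w p q p<N Q<N q≡1+Q pivots≡0 =
  subst₂ (λ p q → w p q ≡ 0ℚ) p-is-pivot q-is-pivot (pivots≡0 a b)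
  where
  a = fromℕ< p<N
  b = fromℕ< Q<N
  p-is-pivot : pivot-row a ≡ p
  p-is-pivot = Finₚ.toℕ-injective (trans (Finₚ.toℕ-inject≤ a _) (Finₚ.toℕ-fromℕ< p<N))
  q-is-pivot : pivot-col b ≡ q
  q-is-pivot = Finₚ.toℕ-injective
    (trans (cong suc (trans (Finₚ.toℕ-inject≤ b _) (Finₚ.toℕ-fromℕ< Q<N))) (sym q≡1+Q))

-- Rows R = 0 … N-1 are cleared top-down: (R, 0) is the only possibly nonzero square on its
-- diagonal, (R, N+2) on its anti-diagonal, columns 1 … N hold pivots, and the row sum then
-- clears (R, N+1). Columns C are then cleared left to right, using the diagonal through (N, C),
-- the anti-diagonal through (N+2, C) and finally the column sum for (N+1, C).
module Vanishing (N : ℕ) (w : Vec² (3 ℕ.+ N)) (zero-lines : ZeroLineSums w)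
  (pivots≡0 : ∀ a b → w (pivot-row a) (pivot-col b) ≡ 0ℚ) where

  private
    n = 3 ℕ.+ N

  alone-on-line : ∀ d p q →
    (∀ p' q' → lineKey d p' q' ≡ lineKey d p q → ¬ (p' ≡ p × q' ≡ q) → w p' q' ≡ 0ℚ) →
    w p q ≡ 0ℚ
  alone-on-line d p q = fibre-singleton (lineKey d) w p q (zero-lines d (lineKey d p q))

  same-cell : ∀ {p' q' p q : Fin n} → toℕ p' ≡ toℕ p → toℕ q' ≡ toℕ q → p' ≡ p × q' ≡ q
  same-cell p'≡p q'≡q = Finₚ.toℕ-injective p'≡p , Finₚ.toℕ-injective q'≡q

  anti-line : ∀ (p' q' p q : Fin n) →
              lineKey anti p' q' ≡ lineKey anti p q → toℕ p' ℕ.+ toℕ q ≡ toℕ p ℕ.+ toℕ q'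
  anti-line p' q' p q = proj₁ (anti-key-≡ n (index≤n q') (index≤n q))
    where
    index≤n : (i : Fin n) → toℕ i ≤ n
    index≤n i = ℕₚ.<⇒≤ (Finₚ.toℕ<n i)

  index≤N+2 : (i : Fin n) → toℕ i ≤ suc (suc N)
  index≤N+2 i = ℕₚ.≤-pred (Finₚ.toℕ<n i)

  module Row (R : ℕ) (R<N : R < N) (above : ∀ p q → toℕ p < R → w p q ≡ 0ℚ) where

    first-col : ∀ p q → toℕ p ≡ R → toℕ q ≡ 0 → w p q ≡ 0ℚ
    first-col p q p≡R q≡0 = alone-on-line diag p q others
      where
      balance : ∀ p' q' → lineKey diag p' q' ≡ lineKey diag p q → toℕ p' ℕ.+ toℕ q' ≡ R ℕ.+ 0
      balance p' q' on-line = trans on-line (cong₂ ℕ._+_ p≡R q≡0)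
      others : ∀ p' q' → lineKey diag p' q' ≡ lineKey diag p q → ¬ (p' ≡ p × q' ≡ q) →
               w p' q' ≡ 0ℚ
      others p' q' on-line ≢cell with toℕ p' ℕ.≟ R
      ... | yes p'≡R = ⊥-elim (≢cell (same-cell (trans p'≡R (sym p≡R))
                         (trans (+-balance-≡ (balance p' q' on-line) p'≡R) (sym q≡0))))
      ... | no  p'≢R = above p' q' (ℕₚ.≤∧≢⇒< (+-balance-≤ (balance p' q' on-line) z≤n) p'≢R)

    last-col : ∀ p q → toℕ p ≡ R → toℕ q ≡ suc (suc N) → w p q ≡ 0ℚ
    last-col p q p≡R q≡N+2 = alone-on-line anti p q others
      where
      balance : ∀ p' q' → lineKey anti p' q' ≡ lineKey anti p q →
                toℕ p' ℕ.+ suc (suc N) ≡ R ℕ.+ toℕ q'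
      balance p' q' on-line =
        subst₂ (λ x y → toℕ p' ℕ.+ x ≡ y ℕ.+ toℕ q') q≡N+2 p≡R (anti-line p' q' p q on-line)
      others : ∀ p' q' → lineKey anti p' q' ≡ lineKey anti p q → ¬ (p' ≡ p × q' ≡ q) →
               w p' q' ≡ 0ℚ
      others p' q' on-line ≢cell with toℕ p' ℕ.≟ R
      ... | yes p'≡R = ⊥-elim (≢cell (same-cell (trans p'≡R (sym p≡R))
                         (trans (sym (+-balance-≡ (balance p' q' on-line) p'≡R)) (sym q≡N+2))))
      ... | no  p'≢R =
        above p' q' (ℕₚ.≤∧≢⇒< (+-balance-≤ (balance p' q' on-line) (index≤N+2 q')) p'≢R)

    row-but-N+1 : ∀ p q → toℕ p ≡ R → toℕ q ≢ suc N → w p q ≡ 0ℚ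
    row-but-N+1 p q p≡R q≢N+1 with toℕ q in q≡
    ... | zero  = first-col p q p≡R q≡
    ... | suc Q with position N Q (ℕₚ.<⇒≤ (subst (_< n) q≡ (Finₚ.toℕ<n q)))
    ...   | inj₁ Q<N = pivot-cell w p q (subst (_< N) (sym p≡R) R<N) Q<N q≡ pivots≡0
    ...   | inj₂ (inj₁ refl)         = ⊥-elim (q≢N+1 refl)
    ...   | inj₂ (inj₂ (inj₁ refl))  = last-col p q p≡R q≡
    ...   | inj₂ (inj₂ (inj₂ refl))  = ⊥-elim (ℕₚ.<-irrefl q≡ (Finₚ.toℕ<n q))

    row-cleared : ∀ p q → toℕ p ≡ R → w p q ≡ 0ℚ
    row-cleared p q p≡R with toℕ q ℕ.≟ suc N
    ... | no  q≢N+1 = row-but-N+1 p q p≡R q≢N+1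
    ... | yes q≡N+1 = alone-on-line row p q (λ p' q' on-row ≢cell →
      row-but-N+1 p' q' (trans on-row p≡R)
        (λ q'≡N+1 → ≢cell (same-cell on-row (trans q'≡N+1 (sym q≡N+1)))))

  rows-below : ∀ R → R ≤ N → ∀ p q → toℕ p < R → w p q ≡ 0ℚ
  rows-below (suc R) R<N p q p<1+R with toℕ p ℕ.≟ R
  ... | yes p≡R = Row.row-cleared R R<N (rows-below R (ℕₚ.<⇒≤ R<N)) p q p≡R
  ... | no  p≢R = rows-below R (ℕₚ.<⇒≤ R<N) p q (ℕₚ.≤∧≢⇒< (ℕₚ.≤-pred p<1+R) p≢R)

  top-rows : ∀ p q → toℕ p < N → w p q ≡ 0ℚ
  top-rows = rows-below N ℕₚ.≤-refl

  module Column (C : ℕ) (left : ∀ p q → toℕ q < C → w p q ≡ 0ℚ) where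

    row-N : ∀ p q → toℕ p ≡ N → toℕ q ≡ C → w p q ≡ 0ℚ
    row-N p q p≡N q≡C = alone-on-line diag p q others
      where
      balance : ∀ p' q' → lineKey diag p' q' ≡ lineKey diag p q → toℕ p' ℕ.+ toℕ q' ≡ N ℕ.+ C
      balance p' q' on-line = trans on-line (cong₂ ℕ._+_ p≡N q≡C)
      others : ∀ p' q' → lineKey diag p' q' ≡ lineKey diag p q → ¬ (p' ≡ p × q' ≡ q) →
               w p' q' ≡ 0ℚ
      others p' q' on-line ≢cell with ℕₚ.<-cmp (toℕ p') N
      ... | tri< p'<N _ _ = top-rows p' q' p'<N
      ... | tri≈ _ p'≡N _ = ⊥-elim (≢cell (same-cell (trans p'≡N (sym p≡N))
                              (trans (+-balance-≡ (balance p' q' on-line) p'≡N) (sym q≡C))))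
      ... | tri> _ _ p'>N = left p' q' (ℕₚ.+-cancelˡ-< N (toℕ q') C
                              (ℕₚ.<-≤-trans (ℕₚ.+-monoˡ-< (toℕ q') p'>N)
                                            (ℕₚ.≤-reflexive (balance p' q' on-line))))

    row-N+2 : ∀ p q → toℕ p ≡ suc (suc N) → toℕ q ≡ C → w p q ≡ 0ℚ
    row-N+2 p q p≡N+2 q≡C = alone-on-line anti p q others
      where
      balance : ∀ p' q' → lineKey anti p' q' ≡ lineKey anti p q →
                toℕ q' ℕ.+ suc (suc N) ≡ C ℕ.+ toℕ p'
      balance p' q' on-line = trans (ℕₚ.+-comm (toℕ q') _)
        (trans (sym (subst₂ (λ x y → toℕ p' ℕ.+ x ≡ y ℕ.+ toℕ q') q≡C p≡N+2
                            (anti-line p' q' p q on-line)))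
               (ℕₚ.+-comm (toℕ p') C))
      others : ∀ p' q' → lineKey anti p' q' ≡ lineKey anti p q → ¬ (p' ≡ p × q' ≡ q) →
               w p' q' ≡ 0ℚ
      others p' q' on-line ≢cell with toℕ q' ℕ.≟ C
      ... | yes q'≡C = ⊥-elim (≢cell (same-cell
                         (trans (sym (+-balance-≡ (balance p' q' on-line) q'≡C)) (sym p≡N+2))
                         (trans q'≡C (sym q≡C))))
      ... | no  q'≢C =
        left p' q' (ℕₚ.≤∧≢⇒< (+-balance-≤ (balance p' q' on-line) (index≤N+2 p')) q'≢C)

    column-but-N+1 : ∀ p q → toℕ q ≡ C → toℕ p ≢ suc N → w p q ≡ 0ℚ
    column-but-N+1 p q q≡C p≢N+1 with position N (toℕ p) (Finₚ.toℕ<n p)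
    ... | inj₁ p<N                 = top-rows p q p<N
    ... | inj₂ (inj₁ p≡N)          = row-N p q p≡N q≡C
    ... | inj₂ (inj₂ (inj₁ p≡N+1)) = ⊥-elim (p≢N+1 p≡N+1)
    ... | inj₂ (inj₂ (inj₂ p≡N+2)) = row-N+2 p q p≡N+2 q≡C

    column-cleared : ∀ p q → toℕ q ≡ C → w p q ≡ 0ℚ
    column-cleared p q q≡C with toℕ p ℕ.≟ suc N
    ... | no  p≢N+1 = column-but-N+1 p q q≡C p≢N+1
    ... | yes p≡N+1 = alone-on-line col p q (λ p' q' on-column ≢cell →
      column-but-N+1 p' q' (trans on-column q≡C)
        (λ p'≡N+1 → ≢cell (same-cell (trans p'≡N+1 (sym p≡N+1)) on-column)))

  columns-left-of : ∀ C → ∀ p q → toℕ q < C → w p q ≡ 0ℚ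
  columns-left-of (suc C) p q q<1+C with toℕ q ℕ.≟ C
  ... | yes q≡C = Column.column-cleared C (columns-left-of C) p q q≡C
  ... | no  q≢C = columns-left-of C p q (ℕₚ.≤∧≢⇒< (ℕₚ.≤-pred q<1+C) q≢C)

  vanishes : ∀ p q → w p q ≡ 0ℚ
  vanishes p q = columns-left-of n p q (Finₚ.toℕ<n q)

-- Spanning

fibreSum-+-* : ∀ {n} (τ : Fin n → Fin n → ℕ) (w X : Vec² n) s t →
  fibreSum τ (λ p q → w p q + s * X p q) t ≡ fibreSum τ w t + s * fibreSum τ X t
fibreSum-+-* τ w X s t = begin
  ΣΣ (λ p q → 𝟙 (t ≡ᵇ τ p q) * (w p q + s * X p q))
    ≡⟨ ΣΣ-cong (λ p q → distrib (𝟙 (t ≡ᵇ τ p q)) (w p q) s (X p q)) ⟩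
  ΣΣ (λ p q → 𝟙 (t ≡ᵇ τ p q) * w p q + s * (𝟙 (t ≡ᵇ τ p q) * X p q))
    ≡⟨ ΣΣ-distrib-+ (λ p q → 𝟙 (t ≡ᵇ τ p q) * w p q) (λ p q → s * (𝟙 (t ≡ᵇ τ p q) * X p q)) ⟩
  fibreSum τ w t + ΣΣ (λ p q → s * (𝟙 (t ≡ᵇ τ p q) * X p q))
    ≡⟨ cong (fibreSum τ w t +_) (ΣΣ-*ˡ s (λ p q → 𝟙 (t ≡ᵇ τ p q) * X p q)) ⟩
  fibreSum τ w t + s * fibreSum τ X t ∎
  where
  open ≡-Reasoning
  distrib : ∀ b w s x → b * (w + s * x) ≡ b * w + s * (b * x)
  distrib = Tactic.solve-∀ ℚ-ring

combX-+-δ : ∀ n (c : Fin (n ∸ 3) → Fin (n ∸ 3) → ℚ) a b t i j →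
  combX n (λ a' b' → c a' b' + t * (δ a a' * δ b b')) i j ≡ combX n c i j + t * Xn n a b i j
combX-+-δ n c a b t i j = begin
  ΣΣ (λ a' b' → (c a' b' + t * (δ a a' * δ b b')) * X a' b')
    ≡⟨ ΣΣ-cong (λ a' b' → distrib (c a' b') t (δ a a' * δ b b') (X a' b')) ⟩
  ΣΣ (λ a' b' → c a' b' * X a' b' + t * ((δ a a' * δ b b') * X a' b'))
    ≡⟨ ΣΣ-distrib-+ (λ a' b' → c a' b' * X a' b') (λ a' b' → t * ((δ a a' * δ b b') * X a' b')) ⟩
  combX n c i j + ΣΣ (λ a' b' → t * ((δ a a' * δ b b') * X a' b'))
    ≡⟨ cong (combX n c i j +_) (ΣΣ-*ˡ t (λ a' b' → (δ a a' * δ b b') * X a' b')) ⟩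
  combX n c i j + t * ΣΣ (λ a' b' → (δ a a' * δ b b') * X a' b')
    ≡⟨ cong (λ x → combX n c i j + t * x) (ΣΣ-δ X a b) ⟩
  combX n c i j + t * Xn n a b i j ∎
  where
  open ≡-Reasoning
  X : Fin (n ∸ 3) → Fin (n ∸ 3) → ℚ
  X a' b' = Xn n a' b' i j
  distrib : ∀ c t d x → (c + t * d) * x ≡ c * x + t * (d * x)
  distrib = Tactic.solve-∀ ℚ-ring

-- Gaussian elimination along the pivots in lexicographic order: subtracting a multiple of
-- X^{(a,b)} clears the pivot of (a,b) without disturbing earlier pivots or any line sum.
module Spanning (N : ℕ) (v : Vec² (3 ℕ.+ N)) (v-lines : ZeroLineSums v) where

  private
    n = 3 ℕ.+ N

  record Decomposition (x y : ℕ) : Set where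
    field
      coeff        : Fin N → Fin N → ℚ
      rest         : Vec² n
      v≡combX+rest : ∀ i j → v i j ≡ combX n coeff i j + rest i j
      rest-lines   : ZeroLineSums rest
      rest-pivots  : ∀ a b → (toℕ a , toℕ b) <ₗₑₓ (x , y) → rest (pivot-row a) (pivot-col b) ≡ 0ℚ

  initial : Decomposition 0 0
  initial = record
    { coeff        = λ _ _ → 0ℚ
    ; rest         = v
    ; v≡combX+rest = λ i j → sym (trans (cong (_+ v i j) (combX-0 i j)) (ℚₚ.+-identityˡ (v i j)))
    ; rest-lines   = v-lines
    ; rest-pivots  = λ _ _ → ⊥-elim ∘′ <ₗₑₓ-origin
    }
    where
    combX-0 : ∀ i j → combX n (λ _ _ → 0ℚ) i j ≡ 0ℚ
    combX-0 i j = ΣΣ-≡0 (λ a b → ℚₚ.*-zeroˡ (Xn n a b i j))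

  eliminate : ∀ a b → Decomposition (toℕ a) (toℕ b) → Decomposition (toℕ a) (suc (toℕ b))
  eliminate a b D = record
    { coeff        = λ a' b' → coeff a' b' + t * (δ a a' * δ b b')
    ; rest         = rest′
    ; v≡combX+rest = λ i j → trans (v≡combX+rest i j)
        (trans (regroup (combX n coeff i j) (rest i j) t (X i j))
               (cong (_+ rest′ i j) (sym (combX-+-δ n coeff a b t i j))))
    ; rest-lines   = λ d s → trans (fibreSum-+-* (lineKey d) rest X (- t) s)
        (vanish (rest-lines d s) (X-lineSum≡0 N a b d s))
    ; rest-pivots  = pivots
    }
    where
    open Decomposition D
    t = rest (pivot-row a) (pivot-col b)
    X = Xn n a b
    rest′ : Vec² n
    rest′ p q = rest p q + (- t) * X p q
    regroup : ∀ c r t x → c + r ≡ (c + t * x) + (r + (- t) * x)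
    regroup = Tactic.solve-∀ ℚ-ring
    vanish : ∀ {r x} → r ≡ 0ℚ → x ≡ 0ℚ → r + (- t) * x ≡ 0ℚ
    vanish refl refl = zero-plus (- t)
      where
      zero-plus : ∀ s → 0ℚ + s * 0ℚ ≡ 0ℚ
      zero-plus = Tactic.solve-∀ ℚ-ring
    pivots : ∀ a' b' → (toℕ a' , toℕ b') <ₗₑₓ (toℕ a , suc (toℕ b)) →
             rest′ (pivot-row a') (pivot-col b') ≡ 0ℚ
    pivots a' b' before with <ₗₑₓ-suc before
    ... | inj₁ before' = vanish (rest-pivots a' b' before')
                                (trans (X-at-pivot a b a' b') (X4-at-earlier-pivot before'))
    ... | inj₂ (a'≡a , b'≡b) rewrite Finₚ.toℕ-injective a'≡a | Finₚ.toℕ-injective b'≡b =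
      trans (cong (λ x → t + (- t) * x)
                  (trans (X-at-pivot a b a b) (X4-at-pivot (toℕ a) (toℕ b))))
            (cancel t)
      where
      cancel : ∀ t → t + (- t) * 1ℚ ≡ 0ℚ
      cancel = Tactic.solve-∀ ℚ-ring

  next-row : ∀ x → Decomposition x N → Decomposition (suc x) 0
  next-row x D = record
    { coeff        = coeff
    ; rest         = rest
    ; v≡combX+rest = v≡combX+rest
    ; rest-lines   = rest-lines
    ; rest-pivots  = λ a b before → rest-pivots a b (<ₗₑₓ-next-row before (Finₚ.toℕ<n b))
    }
    where open Decomposition D

  spans : Σ (Fin N → Fin N → ℚ) (λ c → ∀ i j → v i j ≡ combX n c i j)
  spans = coeff , λ i j → begin
    v i j                         ≡⟨ v≡combX+rest i j ⟩
    combX n coeff i j + rest i j  ≡⟨ cong (combX n coeff i j +_) (rest≡0 i j) ⟩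
    combX n coeff i j + 0ℚ        ≡⟨ ℚₚ.+-identityʳ _ ⟩
    combX n coeff i j             ∎
    where
    open ≡-Reasoning
    open Decomposition (lex-induction N Decomposition initial eliminate next-row)
    rest≡0 : ∀ i j → rest i j ≡ 0ℚ
    rest≡0 = Vanishing.vanishes N rest rest-lines (λ a b → rest-pivots a b (inj₁ (Finₚ.toℕ<n a)))

theorem9 : ∀ (n : ℕ) → 4 ≤ n →
      -- every X_n^{(a,b)} lies in the (-4)-eigenspace
      (∀ (a b : Fin (n ∸ 3)) → InEigenspace n minus4 (Xn n a b))
    × -- the family F_n is linearly independent
      (∀ (c : Fin (n ∸ 3) → Fin (n ∸ 3) → ℚ) →
         (∀ i j → combX n c i j ≡ 0ℚ) →
         ∀ a b → c a b ≡ 0ℚ)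
    × -- the family F_n spans the (-4)-eigenspace
      (∀ (v : Vec² n) → InEigenspace n minus4 v →
         Σ (Fin (n ∸ 3) → Fin (n ∸ 3) → ℚ) (λ c → ∀ i j → v i j ≡ combX n c i j))
theorem9 (suc (suc (suc N))) (s≤s (s≤s (s≤s _))) =
    X-eigenvector N
  , combX-injective N
  , λ v eigen → Spanning.spans N v (Equivalence.to (eigenspace⇔ZeroLineSums v) eigen)
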